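{- Let $n>0$ have binary expansion $n_kn_{k-1}\cdots n_0$ with $n_k=1$ (so $k=\lfloor\log_2(n)\rfloor$). Then the number $\delta(n)$ of $D$-nodes in the divide-and-conquer tree with $n$ leaves satisfies $$\delta(n)=\sum_{i=0}^{k-1}2^i n_i\Bigl[(k-i)-2\sum_{j=i}^{k}n_j+4\Bigr]=\sum_{i=0}^{k-1}2^i n_i\Bigl[(k-i)-2\,\omega\bigl(\lfloor n/2^i\rfloor\bigr)+4\Bigr],$$ where $\omega(m)$ is the number of $1$s in the binary expansion of $m$.
   Context: A full binary tree is a rooted tree in which every node has $0$ or $2$ children. An internal node is a $D$-node if its two children have different numbers of descendant leaves. A divide-and-conquer tree is a full binary tree in which, at every internal node, the numbers of leaves of the left and right subtrees differ by at most $1$; it is unique up to isomorphism for each number of leaves. -}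

module Defs where

open import Data.Nat using (ℕ; zero; suc; _+_; _*_; _∸_; _^_; _≤_; _<_)
open import Data.Nat.DivMod using (_/_; _%_)
open import Data.Nat.Logarithm using (⌊log₂_⌋)
open import Data.Integer using (ℤ; +_)
import Data.Integer as ℤ
open import Data.Bool using (if_then_else_)
open import Relation.Nullary.Decidable using (⌊_⌋)
import Data.Nat as ℕ
open import Data.Nat.Properties using (m^n≢0)

data Tree : Set where
  leaf : Tree
  node : Tree → Tree → Tree

leaves : Tree → ℕ
leaves leaf = 1
leaves (node l r) = leaves l + leaves r

dnodes : Tree → ℕ
dnodes leaf = 0
dnodes (node l r) =
  (if ⌊ leaves l ℕ.≟ leaves r ⌋ then 0 else 1) + dnodes l + dnodes r

data IsDC : Tree → Set where
  dc-leaf : IsDC leaf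
  dc-node : ∀ {l r} → leaves l ≤ leaves r + 1 → leaves r ≤ leaves l + 1 →
            IsDC l → IsDC r → IsDC (node l r)

div2^ : ℕ → ℕ → ℕ
div2^ n i = n / 2 ^ i
  where instance _ = m^n≢0 2 i

bit : ℕ → ℕ → ℕ
bit n i = div2^ n i % 2

-- number of 1s in binary expansion (fuel-based; fuel m suffices)
ωfuel : ℕ → ℕ → ℕ
ωfuel zero m = 0
ωfuel (suc f) m = m % 2 + ωfuel f (m / 2)

ω : ℕ → ℕ
ω m = ωfuel m m

Σℤ : ℕ → (ℕ → ℤ) → ℤ
Σℤ zero f = + 0
Σℤ (suc k) f = Σℤ k f ℤ.+ f k

Σℕfrom : ℕ → ℕ → (ℕ → ℕ) → ℕ
Σℕfrom i k g = go (suc k ∸ i)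
  where
  go : ℕ → ℕ
  go zero = 0
  go (suc t) = go t + g (i + t)

{-# OPTIONS --safe #-}
-- Splitting n leaves as evenly as possible gives subtrees with ⌊n/2⌋ and ⌈n/2⌉
-- leaves, so δ is determined by δ(1) = 0, δ(2m) = 2δ(m) and
-- δ(2m+1) = 1 + δ(m) + δ(m+1).  Let F(n) be the digit sum of the theorem and
-- c(n,i) the number of ones among n_i, …, n_k.  Stripping the last digit gives
-- F(n) = n_0 (k + 4 − 2c(n,0)) + 2F(⌊n/2⌋), hence F(2m) = 2F(m) and
-- F(2m+1) = 2F(m) + ⌊log₂ m⌋ + 3 − 2ω(m).  Induction along the binary expansion
-- then gives F(m+1) − F(m) = ⌊log₂ m⌋ + 2 − 2ω(m), and with it
-- F(2m+1) = 1 + F(m) + F(m+1).  Only c(n,i+1) = c(⌊n/2⌋,i) and c(n,0) = ω(n)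
-- are ever used, which is why both forms of the sum are covered at once.
module Submission where

open import Defs
open import Data.Nat using (ℕ; zero; suc; _<_; _≤_; _^_; _∸_; z≤n; s≤s; ⌊_/2⌋)
import Data.Nat as ℕ
import Data.Nat.Properties as ℕₚ
open import Data.Nat.DivMod
  using (_/_; _%_; m*n%n≡0; [m+kn]%n≡m%n; n/1≡n; m/n/o≡m/[n*o]; m/n≡1+[m∸n]/n)
open import Data.Nat.Logarithm using (⌊log₂_⌋; ⌊log₂⌊n/2⌋⌋≡⌊log₂n⌋∸1; ⌊log₂⌋-mono-≤)
open import Data.Integer using (ℤ; +_; _+_; _-_; _*_)
import Data.Integer.Properties as ℤₚ
open import Data.Integer.Tactic.RingSolver using (solve-∀)
open import Data.Product using (_×_; _,_)
open import Data.Sum using (_⊎_; inj₁; inj₂)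
open import Data.Bool using (if_then_else_)
open import Function using (_∘_)
open import Relation.Binary.PropositionalEquality
open import Relation.Binary using (tri<; tri≈; tri>)
open import Relation.Nullary using (yes; no; contradiction)
open import Relation.Nullary.Decidable using (⌊_⌋)
open ≡-Reasoning

m+m≡m*2 : ∀ m → m ℕ.+ m ≡ m ℕ.* 2
m+m≡m*2 m = trans (cong (m ℕ.+_) (sym (ℕₚ.+-identityʳ m))) (ℕₚ.*-comm 2 m)

n/2≡⌊n/2⌋ : ∀ n → n / 2 ≡ ⌊ n /2⌋
n/2≡⌊n/2⌋ zero = refl
n/2≡⌊n/2⌋ (suc zero) = refl
n/2≡⌊n/2⌋ (suc (suc n)) =
  trans (m/n≡1+[m∸n]/n {suc (suc n)} (s≤s (s≤s z≤n))) (cong suc (n/2≡⌊n/2⌋ n))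

[m+m]/2≡m : ∀ m → (m ℕ.+ m) / 2 ≡ m
[m+m]/2≡m m = trans (n/2≡⌊n/2⌋ _) (sym (ℕₚ.n≡⌊n+n/2⌋ m))

[1+m+m]/2≡m : ∀ m → suc (m ℕ.+ m) / 2 ≡ m
[1+m+m]/2≡m m = trans (n/2≡⌊n/2⌋ _) (sym (ℕₚ.n≡⌈n+n/2⌉ m))

[m+m]%2≡0 : ∀ m → (m ℕ.+ m) % 2 ≡ 0
[m+m]%2≡0 m = trans (cong (_% 2) (m+m≡m*2 m)) (m*n%n≡0 m 2)

[1+m+m]%2≡1 : ∀ m → suc (m ℕ.+ m) % 2 ≡ 1
[1+m+m]%2≡1 m = trans (cong (λ x → suc x % 2) (m+m≡m*2 m)) ([m+kn]%n≡m%n 1 m 2)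

2≤m+m : ∀ {m} → 1 ≤ m → 2 ≤ m ℕ.+ m
2≤m+m 1≤m = ℕₚ.+-mono-≤ 1≤m 1≤m

2≤1+m+m : ∀ {m} → 1 ≤ m → 2 ≤ suc (m ℕ.+ m)
2≤1+m+m 1≤m = ℕₚ.m≤n⇒m≤1+n (2≤m+m 1≤m)

⌊log₂n⌋≡1+⌊log₂[n/2]⌋ : ∀ n → 2 ≤ n → ⌊log₂ n ⌋ ≡ suc ⌊log₂ (n / 2) ⌋
⌊log₂n⌋≡1+⌊log₂[n/2]⌋ n 2≤n = begin
  ⌊log₂ n ⌋              ≡⟨ ℕₚ.m+[n∸m]≡n (⌊log₂⌋-mono-≤ 2≤n) ⟨
  suc (⌊log₂ n ⌋ ∸ 1)    ≡⟨ cong suc (⌊log₂⌊n/2⌋⌋≡⌊log₂n⌋∸1 n) ⟨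
  suc ⌊log₂ ⌊ n /2⌋ ⌋    ≡⟨ cong (suc ∘ ⌊log₂_⌋) (n/2≡⌊n/2⌋ n) ⟨
  suc ⌊log₂ (n / 2) ⌋    ∎

⌊log₂[m+m]⌋≡1+⌊log₂m⌋ : ∀ {m} → 1 ≤ m → ⌊log₂ (m ℕ.+ m) ⌋ ≡ suc ⌊log₂ m ⌋
⌊log₂[m+m]⌋≡1+⌊log₂m⌋ {m} 1≤m =
  trans (⌊log₂n⌋≡1+⌊log₂[n/2]⌋ _ (2≤m+m 1≤m)) (cong (suc ∘ ⌊log₂_⌋) ([m+m]/2≡m m))

⌊log₂[1+m+m]⌋≡1+⌊log₂m⌋ : ∀ {m} → 1 ≤ m → ⌊log₂ (suc (m ℕ.+ m)) ⌋ ≡ suc ⌊log₂ m ⌋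
⌊log₂[1+m+m]⌋≡1+⌊log₂m⌋ {m} 1≤m =
  trans (⌊log₂n⌋≡1+⌊log₂[n/2]⌋ _ (2≤1+m+m 1≤m)) (cong (suc ∘ ⌊log₂_⌋) ([1+m+m]/2≡m m))

data Bin⁺ : ℕ → Set where
  one      : Bin⁺ 1
  double   : ∀ {m} → Bin⁺ m → Bin⁺ (m ℕ.+ m)
  double+1 : ∀ {m} → Bin⁺ m → Bin⁺ (suc (m ℕ.+ m))

Bin⁺-suc : ∀ {m} → Bin⁺ m → Bin⁺ (suc m)
Bin⁺-suc one = double one
Bin⁺-suc (double b) = double+1 b
Bin⁺-suc (double+1 {m} b) = subst Bin⁺ (cong suc (ℕₚ.+-suc m m)) (double (Bin⁺-suc b))

toBin⁺ : ∀ {m} → 1 ≤ m → Bin⁺ m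
toBin⁺ {suc zero} _ = one
toBin⁺ {suc (suc m)} _ = Bin⁺-suc (toBin⁺ (s≤s z≤n))

Bin⁺⇒1≤ : ∀ {m} → Bin⁺ m → 1 ≤ m
Bin⁺⇒1≤ one = s≤s z≤n
Bin⁺⇒1≤ (double b) = ℕₚ.≤-trans (Bin⁺⇒1≤ b) (ℕₚ.m≤m+n _ _)
Bin⁺⇒1≤ (double+1 b) = s≤s z≤n

div2^-suc : ∀ n i → div2^ n (suc i) ≡ div2^ (n / 2) i
div2^-suc n i = sym (m/n/o≡m/[n*o] n 2 (2 ^ i) {{_}} {{ℕₚ.m^n≢0 2 i}} {{ℕₚ.m^n≢0 2 (suc i)}})

div2^-zero : ∀ n → div2^ n 0 ≡ n
div2^-zero = n/1≡n

bit-zero : ∀ n → bit n 0 ≡ n % 2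
bit-zero n = cong (_% 2) (div2^-zero n)

bit-suc : ∀ n i → bit n (suc i) ≡ bit (n / 2) i
bit-suc n i = cong (_% 2) (div2^-suc n i)

ωfuel-zero : ∀ f → ωfuel f 0 ≡ 0
ωfuel-zero zero = refl
ωfuel-zero (suc f) = ωfuel-zero f

[1+m]/2≤m : ∀ m → suc m / 2 ≤ m
[1+m]/2≤m m = subst (_≤ m) (sym (n/2≡⌊n/2⌋ (suc m))) (ℕₚ.⌈n/2⌉≤n m)

ωfuel-irrelevant : ∀ f g m → m ≤ f → m ≤ g → ωfuel f m ≡ ωfuel g m
ωfuel-irrelevant f g zero _ _ = trans (ωfuel-zero f) (sym (ωfuel-zero g))
ωfuel-irrelevant (suc f) (suc g) (suc m) (s≤s m≤f) (s≤s m≤g) =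
  cong (suc m % 2 ℕ.+_) (ωfuel-irrelevant f g (suc m / 2)
    (ℕₚ.≤-trans ([1+m]/2≤m m) m≤f) (ℕₚ.≤-trans ([1+m]/2≤m m) m≤g))

ω-half : ∀ n → 1 ≤ n → ω n ≡ n % 2 ℕ.+ ω (n / 2)
ω-half (suc m) _ =
  cong (suc m % 2 ℕ.+_) (ωfuel-irrelevant m (suc m / 2) (suc m / 2) ([1+m]/2≤m m) ℕₚ.≤-refl)

∑ : ℕ → (ℕ → ℕ) → ℕ
∑ zero f = 0
∑ (suc t) f = ∑ t f ℕ.+ f t

∑-cong : ∀ t {f g} → (∀ s → f s ≡ g s) → ∑ t f ≡ ∑ t g
∑-cong zero f≗g = refl
∑-cong (suc t) f≗g = cong₂ ℕ._+_ (∑-cong t f≗g) (f≗g t)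

∑-head : ∀ t f → ∑ (suc t) f ≡ f 0 ℕ.+ ∑ t (f ∘ suc)
∑-head zero f = ℕₚ.+-comm 0 (f 0)
∑-head (suc t) f = trans (cong (ℕ._+ f (suc t)) (∑-head t f)) (ℕₚ.+-assoc (f 0) _ _)

∑-unique : ∀ {f} (h : ℕ → ℕ) → h 0 ≡ 0 → (∀ t → h (suc t) ≡ h t ℕ.+ f t) → ∀ t → h t ≡ ∑ t f
∑-unique h h0 hsuc zero = h0
∑-unique {f} h h0 hsuc (suc t) = trans (hsuc t) (cong (ℕ._+ f t) (∑-unique h h0 hsuc t))

Σℕfrom≡∑ : ∀ i k g → Σℕfrom i k g ≡ ∑ (suc k ∸ i) (λ t → g (i ℕ.+ t))
-- Σℕfrom i k g unfolds to a local function of Defs applied to suc k ∸ i; once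
-- that argument is abstracted, the meta below is solved by the local function.
Σℕfrom≡∑ i k g with ∑-unique _ refl (λ _ → refl) | suc k ∸ i
... | go≡∑ | t = go≡∑ t

Σℕfrom-cong : ∀ i k {g h} → (∀ j → g j ≡ h j) → Σℕfrom i k g ≡ Σℕfrom i k h
Σℕfrom-cong i k {g} {h} g≗h = begin
  Σℕfrom i k g                       ≡⟨ Σℕfrom≡∑ i k g ⟩
  ∑ (suc k ∸ i) (λ t → g (i ℕ.+ t))  ≡⟨ ∑-cong (suc k ∸ i) (g≗h ∘ (i ℕ.+_)) ⟩
  ∑ (suc k ∸ i) (λ t → h (i ℕ.+ t))  ≡⟨ Σℕfrom≡∑ i k h ⟨
  Σℕfrom i k h                       ∎

Σℕfrom-suc : ∀ i k g → Σℕfrom (suc i) (suc k) g ≡ Σℕfrom i k (g ∘ suc)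
Σℕfrom-suc i k g = trans (Σℕfrom≡∑ (suc i) (suc k) g) (sym (Σℕfrom≡∑ i k (g ∘ suc)))

Σℕfrom-zero : ∀ k g → Σℕfrom 0 (suc k) g ≡ g 0 ℕ.+ Σℕfrom 0 k (g ∘ suc)
Σℕfrom-zero k g = begin
  Σℕfrom 0 (suc k) g               ≡⟨ Σℕfrom≡∑ 0 (suc k) g ⟩
  ∑ (suc (suc k)) g                ≡⟨ ∑-head (suc k) g ⟩
  g 0 ℕ.+ ∑ (suc k) (g ∘ suc)      ≡⟨ cong (g 0 ℕ.+_) (Σℕfrom≡∑ 0 k (g ∘ suc)) ⟨
  g 0 ℕ.+ Σℕfrom 0 k (g ∘ suc)     ∎

Σℤ-cong : ∀ k {f g : ℕ → ℤ} → (∀ i → f i ≡ g i) → Σℤ k f ≡ Σℤ k g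
Σℤ-cong zero f≗g = refl
Σℤ-cong (suc k) f≗g = cong₂ _+_ (Σℤ-cong k f≗g) (f≗g k)

Σℤ-head : ∀ k f → Σℤ (suc k) f ≡ f 0 + Σℤ k (f ∘ suc)
Σℤ-head zero f = trans (ℤₚ.+-identityˡ (f 0)) (sym (ℤₚ.+-identityʳ (f 0)))
Σℤ-head (suc k) f = trans (cong (_+ f (suc k)) (Σℤ-head k f)) (ℤₚ.+-assoc (f 0) _ _)

Σℤ-*ˡ : ∀ k a f → Σℤ k (λ i → a * f i) ≡ a * Σℤ k f
Σℤ-*ˡ zero a f = sym (ℤₚ.*-zeroʳ a)
Σℤ-*ˡ (suc k) a f = trans (cong (_+ a * f k) (Σℤ-*ˡ k a f)) (sym (ℤₚ.*-distribˡ-+ a (Σℤ k f) (f k)))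

leaves-pos : ∀ T → 1 ≤ leaves T
leaves-pos leaf = s≤s z≤n
leaves-pos (node l r) = ℕₚ.≤-trans (leaves-pos l) (ℕₚ.m≤m+n (leaves l) (leaves r))

adjacent : ∀ {a b} → a ≤ b ℕ.+ 1 → b ≤ a ℕ.+ 1 → a ≢ b → b ≡ suc a ⊎ a ≡ suc b
adjacent {a} {b} a≤b+1 b≤a+1 a≢b with ℕₚ.<-cmp a b
... | tri< a<b _ _ = inj₁ (ℕₚ.≤-antisym (subst (b ≤_) (ℕₚ.+-comm a 1) b≤a+1) a<b)
... | tri≈ _ a≡b _ = contradiction a≡b a≢b
... | tri> _ _ b<a = inj₂ (ℕₚ.≤-antisym (subst (a ≤_) (ℕₚ.+-comm b 1) a≤b+1) b<a)

record SolvesDCRecurrence (F : ℕ → ℤ) : Set where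
  field
    at-one      : F 1 ≡ + 0
    at-double   : ∀ m → 1 ≤ m → F (m ℕ.+ m) ≡ + 2 * F m
    at-double+1 : ∀ m → 1 ≤ m → F (m ℕ.+ suc m) ≡ + 1 + F m + F (suc m)

module _ {F : ℕ → ℤ} (solves : SolvesDCRecurrence F) where
  open SolvesDCRecurrence solves

  private
    z+z≡2*z : ∀ z → z + z ≡ + 2 * z
    z+z≡2*z = solve-∀

    1+u+v≡1+v+u : ∀ u v → + 1 + u + v ≡ + 1 + v + u
    1+u+v≡1+v+u = solve-∀

    node-step : ∀ {a b} x y → 1 ≤ a → 1 ≤ b → a ≤ b ℕ.+ 1 → b ≤ a ℕ.+ 1 →
                + x ≡ F a → + y ≡ F b →
                + ((if ⌊ a ℕ.≟ b ⌋ then 0 else 1) ℕ.+ x ℕ.+ y) ≡ F (a ℕ.+ b)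
    node-step {a} {b} x y 1≤a 1≤b a≤b+1 b≤a+1 x≡Fa y≡Fb with a ℕ.≟ b
    ... | yes refl = begin
      + (x ℕ.+ y)       ≡⟨ ℤₚ.pos-+ x y ⟩
      + x + + y         ≡⟨ cong₂ _+_ x≡Fa y≡Fb ⟩
      F a + F a         ≡⟨ z+z≡2*z (F a) ⟩
      + 2 * F a         ≡⟨ at-double a 1≤a ⟨
      F (a ℕ.+ a)       ∎
    ... | no a≢b with adjacent a≤b+1 b≤a+1 a≢b
    ...   | inj₁ refl = begin
      + (1 ℕ.+ x ℕ.+ y)   ≡⟨ ℤₚ.pos-+ (1 ℕ.+ x) y ⟩
      + 1 + + x + + y     ≡⟨ cong₂ (λ u v → + 1 + u + v) x≡Fa y≡Fb ⟩
      + 1 + F a + F b     ≡⟨ at-double+1 a 1≤a ⟨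
      F (a ℕ.+ b)         ∎
    ...   | inj₂ refl = begin
      + (1 ℕ.+ x ℕ.+ y)   ≡⟨ ℤₚ.pos-+ (1 ℕ.+ x) y ⟩
      + 1 + + x + + y     ≡⟨ cong₂ (λ u v → + 1 + u + v) x≡Fa y≡Fb ⟩
      + 1 + F a + F b     ≡⟨ 1+u+v≡1+v+u (F a) (F b) ⟩
      + 1 + F b + F a     ≡⟨ at-double+1 b 1≤b ⟨
      F (b ℕ.+ a)         ≡⟨ cong F (ℕₚ.+-comm b a) ⟩
      F (a ℕ.+ b)         ∎

  IsDC⇒dnodes≡ : ∀ {T} → IsDC T → + dnodes T ≡ F (leaves T)
  IsDC⇒dnodes≡ dc-leaf = sym at-one
  IsDC⇒dnodes≡ (dc-node {l} {r} l≤r+1 r≤l+1 dl dr) =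
    node-step (dnodes l) (dnodes r) (leaves-pos l) (leaves-pos r) l≤r+1 r≤l+1
              (IsDC⇒dnodes≡ dl) (IsDC⇒dnodes≡ dr)

module DigitSum
  (c : ℕ → ℕ → ℕ)
  (c-shift : ∀ n i → 2 ≤ n → c n (suc i) ≡ c (n / 2) i)
  (c-zero : ∀ n → 2 ≤ n → c n 0 ≡ n % 2 ℕ.+ c (n / 2) 0)
  (c-one : c 1 0 ≡ 1)
  where

  term : ℕ → ℕ → ℕ → ℤ
  term n k i = + (2 ^ i ℕ.* bit n i) * (((+ (k ∸ i)) - + 2 * (+ (c n i))) + + 4)

  formula : ℕ → ℤ
  formula n = Σℤ ⌊log₂ n ⌋ (term n ⌊log₂ n ⌋)

  lastDigitTerm : ℕ → ℤ
  lastDigitTerm n = + (n % 2) * (+ suc ⌊log₂ (n / 2) ⌋ - + 2 * + c n 0 + + 4)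

  term-zero : ∀ n k → term n (suc k) 0 ≡ + (n % 2) * (+ suc k - + 2 * + c n 0 + + 4)
  term-zero n k = cong (λ d → + d * (+ suc k - + 2 * + c n 0 + + 4))
                       (trans (ℕₚ.*-identityˡ (bit n 0)) (bit-zero n))

  term-suc : ∀ n k → 2 ≤ n → ∀ i → term n (suc k) (suc i) ≡ + 2 * term (n / 2) k i
  term-suc n k 2≤n i = begin
    + (2 ℕ.* 2 ^ i ℕ.* bit n (suc i)) * r (c n (suc i))
      ≡⟨ cong₂ (λ d w → + (2 ℕ.* 2 ^ i ℕ.* d) * r w) (bit-suc n i) (c-shift n i 2≤n) ⟩
    + (2 ℕ.* 2 ^ i ℕ.* bit (n / 2) i) * ρ
      ≡⟨ cong (λ x → + x * ρ) (ℕₚ.*-assoc 2 (2 ^ i) (bit (n / 2) i)) ⟩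
    + (2 ℕ.* a) * ρ   ≡⟨ cong (_* ρ) (ℤₚ.pos-* 2 a) ⟩
    + 2 * + a * ρ     ≡⟨ ℤₚ.*-assoc (+ 2) (+ a) ρ ⟩
    + 2 * (+ a * ρ)   ∎
    where
    r : ℕ → ℤ
    r w = + (k ∸ i) - + 2 * + w + + 4
    a : ℕ
    a = 2 ^ i ℕ.* bit (n / 2) i
    ρ : ℤ
    ρ = r (c (n / 2) i)

  formula-half : ∀ n → 2 ≤ n → formula n ≡ lastDigitTerm n + + 2 * formula (n / 2)
  formula-half n 2≤n = begin
    Σℤ ⌊log₂ n ⌋ (term n ⌊log₂ n ⌋)
      ≡⟨ cong (λ l → Σℤ l (term n l)) (⌊log₂n⌋≡1+⌊log₂[n/2]⌋ n 2≤n) ⟩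
    Σℤ (suc k) (term n (suc k))
      ≡⟨ Σℤ-head k (term n (suc k)) ⟩
    term n (suc k) 0 + Σℤ k (term n (suc k) ∘ suc)
      ≡⟨ cong₂ _+_ (term-zero n k) (Σℤ-cong k (term-suc n k 2≤n)) ⟩
    lastDigitTerm n + Σℤ k (λ i → + 2 * term (n / 2) k i)
      ≡⟨ cong (λ s → lastDigitTerm n + s) (Σℤ-*ˡ k (+ 2) (term (n / 2) k)) ⟩
    lastDigitTerm n + + 2 * formula (n / 2)
      ∎
    where
    k : ℕ
    k = ⌊log₂ (n / 2) ⌋

  c-double : ∀ {m} → 1 ≤ m → c (m ℕ.+ m) 0 ≡ c m 0
  c-double {m} 1≤m = trans (c-zero _ (2≤m+m 1≤m))
    (cong₂ ℕ._+_ ([m+m]%2≡0 m) (cong (λ h → c h 0) ([m+m]/2≡m m)))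

  c-double+1 : ∀ {m} → 1 ≤ m → c (suc (m ℕ.+ m)) 0 ≡ suc (c m 0)
  c-double+1 {m} 1≤m = trans (c-zero _ (2≤1+m+m 1≤m))
    (cong₂ ℕ._+_ ([1+m+m]%2≡1 m) (cong (λ h → c h 0) ([1+m+m]/2≡m m)))

  increment : ℕ → ℤ
  increment m = + ⌊log₂ m ⌋ + + 2 - + 2 * + c m 0

  increment-double : ∀ {m} → 1 ≤ m → increment (m ℕ.+ m) ≡ + 1 + increment m
  increment-double {m} 1≤m =
    trans (cong₂ (λ l w → + l + + 2 - + 2 * + w) (⌊log₂[m+m]⌋≡1+⌊log₂m⌋ 1≤m) (c-double 1≤m))
          (ring (+ ⌊log₂ m ⌋) (+ c m 0))
    where
    ring : ∀ l w → + 1 + l + + 2 - + 2 * w ≡ + 1 + (l + + 2 - + 2 * w)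
    ring = solve-∀

  increment-double+1 : ∀ {m} → 1 ≤ m → increment (suc (m ℕ.+ m)) ≡ increment m - + 1
  increment-double+1 {m} 1≤m =
    trans (cong₂ (λ l w → + l + + 2 - + 2 * + w) (⌊log₂[1+m+m]⌋≡1+⌊log₂m⌋ 1≤m) (c-double+1 1≤m))
          (ring (+ ⌊log₂ m ⌋) (+ c m 0))
    where
    ring : ∀ l w → + 1 + l + + 2 - + 2 * (+ 1 + w) ≡ l + + 2 - + 2 * w - + 1
    ring = solve-∀

  formula-double : ∀ m → 1 ≤ m → formula (m ℕ.+ m) ≡ + 2 * formula m
  formula-double m 1≤m = begin
    formula (m ℕ.+ m)                                        ≡⟨ formula-half _ (2≤m+m 1≤m) ⟩
    lastDigitTerm (m ℕ.+ m) + + 2 * formula ((m ℕ.+ m) / 2)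
      ≡⟨ cong₂ _+_ even (cong (λ h → + 2 * formula h) ([m+m]/2≡m m)) ⟩
    + 0 + + 2 * formula m                                    ≡⟨ ℤₚ.+-identityˡ _ ⟩
    + 2 * formula m                                          ∎
    where
    even : lastDigitTerm (m ℕ.+ m) ≡ + 0
    even rewrite [m+m]%2≡0 m = refl

  formula-double+1 : ∀ m → 1 ≤ m →
                     formula (suc (m ℕ.+ m)) ≡ + 1 + formula m + (formula m + increment m)
  formula-double+1 m 1≤m = begin
    formula (suc (m ℕ.+ m))                                  ≡⟨ formula-half _ (2≤1+m+m 1≤m) ⟩
    lastDigitTerm (suc (m ℕ.+ m)) + + 2 * formula (suc (m ℕ.+ m) / 2)
      ≡⟨ cong₂ _+_ odd (cong (λ h → + 2 * formula h) ([1+m+m]/2≡m m)) ⟩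
    + 1 * (+ suc ⌊log₂ m ⌋ - + 2 * + suc (c m 0) + + 4) + + 2 * formula m
      ≡⟨ ring (+ ⌊log₂ m ⌋) (+ c m 0) (formula m) ⟩
    + 1 + formula m + (formula m + increment m)              ∎
    where
    odd : lastDigitTerm (suc (m ℕ.+ m)) ≡ + 1 * (+ suc ⌊log₂ m ⌋ - + 2 * + suc (c m 0) + + 4)
    odd rewrite [1+m+m]%2≡1 m | [1+m+m]/2≡m m | c-double+1 1≤m = refl
    ring : ∀ l w f → + 1 * (+ 1 + l - + 2 * (+ 1 + w) + + 4) + + 2 * f
                   ≡ + 1 + f + (f + (l + + 2 - + 2 * w))
    ring = solve-∀

  formula-suc : ∀ {m} → Bin⁺ m → formula (suc m) ≡ formula m + increment m
  formula-suc one rewrite c-one = formula-double 1 (s≤s z≤n)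
  formula-suc (double {p} b) = begin
    formula (suc (p ℕ.+ p))                          ≡⟨ formula-double+1 p 1≤p ⟩
    + 1 + formula p + (formula p + increment p)      ≡⟨ ring (formula p) (increment p) ⟩
    + 2 * formula p + (+ 1 + increment p)
      ≡⟨ cong₂ _+_ (formula-double p 1≤p) (increment-double 1≤p) ⟨
    formula (p ℕ.+ p) + increment (p ℕ.+ p)          ∎
    where
    1≤p : 1 ≤ p
    1≤p = Bin⁺⇒1≤ b
    ring : ∀ f d → + 1 + f + (f + d) ≡ + 2 * f + (+ 1 + d)
    ring = solve-∀
  formula-suc (double+1 {p} b) = begin
    formula (suc (suc (p ℕ.+ p)))                    ≡⟨ cong (formula ∘ suc) (ℕₚ.+-suc p p) ⟨
    formula (suc p ℕ.+ suc p)                        ≡⟨ formula-double (suc p) (s≤s z≤n) ⟩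
    + 2 * formula (suc p)                            ≡⟨ cong (+ 2 *_) (formula-suc b) ⟩
    + 2 * (formula p + increment p)                  ≡⟨ ring (formula p) (increment p) ⟩
    (+ 1 + formula p + (formula p + increment p)) + (increment p - + 1)
      ≡⟨ cong₂ _+_ (formula-double+1 p 1≤p) (increment-double+1 1≤p) ⟨
    formula (suc (p ℕ.+ p)) + increment (suc (p ℕ.+ p)) ∎
    where
    1≤p : 1 ≤ p
    1≤p = Bin⁺⇒1≤ b
    ring : ∀ f d → + 2 * (f + d) ≡ (+ 1 + f + (f + d)) + (d - + 1)
    ring = solve-∀

  formula-solves : SolvesDCRecurrence formula
  formula-solves = record
    { at-one      = refl
    ; at-double   = formula-double
    ; at-double+1 = λ m 1≤m → begin
        formula (m ℕ.+ suc m)                        ≡⟨ cong formula (ℕₚ.+-suc m m) ⟩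
        formula (suc (m ℕ.+ m))                      ≡⟨ formula-double+1 m 1≤m ⟩
        + 1 + formula m + (formula m + increment m)
          ≡⟨ cong (λ s → + 1 + formula m + s) (formula-suc (toBin⁺ 1≤m)) ⟨
        + 1 + formula m + formula (suc m)            ∎
    }

digitSumFrom : ℕ → ℕ → ℕ
digitSumFrom n i = Σℕfrom i ⌊log₂ n ⌋ (bit n)

digitSumFrom-suc : ∀ n i → 2 ≤ n → digitSumFrom n (suc i) ≡ digitSumFrom (n / 2) i
digitSumFrom-suc n i 2≤n = begin
  Σℕfrom (suc i) ⌊log₂ n ⌋ (bit n)
    ≡⟨ cong (λ l → Σℕfrom (suc i) l (bit n)) (⌊log₂n⌋≡1+⌊log₂[n/2]⌋ n 2≤n) ⟩
  Σℕfrom (suc i) (suc k) (bit n)     ≡⟨ Σℕfrom-suc i k (bit n) ⟩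
  Σℕfrom i k (bit n ∘ suc)           ≡⟨ Σℕfrom-cong i k (bit-suc n) ⟩
  Σℕfrom i k (bit (n / 2))           ∎
  where
  k : ℕ
  k = ⌊log₂ (n / 2) ⌋

digitSumFrom-zero : ∀ n → 2 ≤ n → digitSumFrom n 0 ≡ n % 2 ℕ.+ digitSumFrom (n / 2) 0
digitSumFrom-zero n 2≤n = begin
  Σℕfrom 0 ⌊log₂ n ⌋ (bit n)
    ≡⟨ cong (λ l → Σℕfrom 0 l (bit n)) (⌊log₂n⌋≡1+⌊log₂[n/2]⌋ n 2≤n) ⟩
  Σℕfrom 0 (suc k) (bit n)                ≡⟨ Σℕfrom-zero k (bit n) ⟩
  bit n 0 ℕ.+ Σℕfrom 0 k (bit n ∘ suc)
    ≡⟨ cong₂ ℕ._+_ (bit-zero n) (Σℕfrom-cong 0 k (bit-suc n)) ⟩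
  n % 2 ℕ.+ Σℕfrom 0 k (bit (n / 2))      ∎
  where
  k : ℕ
  k = ⌊log₂ (n / 2) ⌋

ωFrom : ℕ → ℕ → ℕ
ωFrom n i = ω (div2^ n i)

ωFrom-zero : ∀ n → 2 ≤ n → ωFrom n 0 ≡ n % 2 ℕ.+ ωFrom (n / 2) 0
ωFrom-zero n 2≤n = begin
  ω (div2^ n 0)                    ≡⟨ cong ω (div2^-zero n) ⟩
  ω n                              ≡⟨ ω-half n (ℕₚ.≤-trans (s≤s z≤n) 2≤n) ⟩
  n % 2 ℕ.+ ω (n / 2)              ≡⟨ cong (λ h → n % 2 ℕ.+ ω h) (div2^-zero (n / 2)) ⟨
  n % 2 ℕ.+ ω (div2^ (n / 2) 0)    ∎

module ByDigitSums = DigitSum digitSumFrom digitSumFrom-suc digitSumFrom-zero refl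
module ByOnes = DigitSum ωFrom (λ n i _ → cong ω (div2^-suc n i)) ωFrom-zero refl

theorem63 : (n : ℕ) → 0 < n → (T : Tree) → IsDC T → leaves T ≡ n →
    let k = ⌊log₂ n ⌋ in
    (+ dnodes T ≡ Σℤ k (λ i → + (2 ^ i ℕ.* bit n i) *
        (((+ (k ∸ i)) - + 2 * (+ (Σℕfrom i k (bit n)))) + + 4)))
    × (+ dnodes T ≡ Σℤ k (λ i → + (2 ^ i ℕ.* bit n i) *
        (((+ (k ∸ i)) - + 2 * (+ (ω (div2^ n i)))) + + 4)))
theorem63 _ _ T dc refl =
  IsDC⇒dnodes≡ ByDigitSums.formula-solves dc , IsDC⇒dnodes≡ ByOnes.formula-solves dc
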